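{- Let $n,k$ be positive integers with $2\leq 2k<n$ and $\gcd(n,k)=1$. Then the maximum frustration of the generalised Petersen graph $P_{n,k}$ satisfies $D(P_{n,k})\leq \lfloor n/2\rfloor+1$.
   Context: For positive integers $n,k$ with $2\le 2k<n$, the generalised Petersen graph $P_{n,k}$ has vertex set $\{u_i,v_i: i\in\{0,\dots,n-1\}\}$ and edge set $\{u_iu_{i+1}, v_iv_{i+k}, u_iv_i : i\in\{0,\dots,n-1\}\}$, indices modulo $n$. A signed graph $(G,E_-)$ is a simple graph $G$ with a set $E_-\subseteq E(G)$ of negative edges (the signature); other edges are positive. A cycle is positive if the product of its edge signs is positive; a signed graph is balanced if every cycle is positive. The frustration index $l(G,E_-)$ is the minimum number of edges whose deletion leaves a balanced signed graph. The maximum frustration of $G$ is $D(G)=\max_{E_-\subseteq E(G)} l(G,E_-)$. -}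

module Defs where

open import Data.Nat using (ℕ; zero; suc; _+_; _*_; _≤_; NonZero)
open import Data.Nat.DivMod using (_%_; m%n<n)
open import Data.Fin using (Fin; toℕ; fromℕ<)
open import Data.Bool using (Bool; true; false; if_then_else_; _xor_)
open import Data.Product using (_×_; _,_; Σ; ∃)
open import Data.Sum using (_⊎_)
open import Data.Nat.ListAction using (sum)
open import Data.List using (List; []; _∷_; map; length; concatMap; allFin; foldr)
open import Data.List.Relation.Unary.All using (All)
open import Data.List.Relation.Unary.Unique.Propositional using (Unique)
open import Relation.Binary.PropositionalEquality using (_≡_)

addMod : (n : ℕ) → .{{_ : NonZero n}} → Fin n → ℕ → Fin n
addMod n i j = fromℕ< (m%n<n (toℕ i + j) n)

-- Vertices of P_{n,k}: (false , i) is u_i, (true , i) is v_i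
Vertex : ℕ → Set
Vertex n = Bool × Fin n

u v : {n : ℕ} → Fin n → Vertex n
u i = false , i
v i = true , i

-- Edge kinds: outer u_i u_{i+1}, spoke u_i v_i, inner v_i v_{i+k}
data EType : Set where
  outer spoke inner : EType

-- Edges of P_{n,k}, indexed by kind and i ∈ {0,…,n-1}.
-- (For 2 ≤ 2k < n these 3n edges are pairwise distinct, so this is E(P_{n,k}).)
Edge : ℕ → Set
Edge n = EType × Fin n

allEdges : (n : ℕ) → List (Edge n)
allEdges n = concatMap (λ i → (outer , i) ∷ (spoke , i) ∷ (inner , i) ∷ []) (allFin n)

endpoints : (n k : ℕ) → .{{_ : NonZero n}} → Edge n → Vertex n × Vertex n
endpoints n k (outer , i) = u i , u (addMod n i 1)
endpoints n k (spoke , i) = u i , v i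
endpoints n k (inner , i) = v i , v (addMod n i k)

Joins : (n k : ℕ) → .{{_ : NonZero n}} → Edge n → Vertex n → Vertex n → Set
Joins n k e a b = (endpoints n k e ≡ (a , b)) ⊎ (endpoints n k e ≡ (b , a))

data Walk (n k : ℕ) .{{_ : NonZero n}} : Vertex n → Vertex n → List (Vertex n) → List (Edge n) → Set where
  nil  : ∀ {x} → Walk n k x x (x ∷ []) []
  cons : ∀ {x y z vs es} (e : Edge n) → Joins n k e x y → Walk n k y z vs es →
         Walk n k x z (x ∷ vs) (e ∷ es)

record Cycle (n k : ℕ) .{{_ : NonZero n}} : Set where
  field
    start end   : Vertex n
    verts       : List (Vertex n)
    pathEdges   : List (Edge n)
    walk        : Walk n k start end verts pathEdges
    closing     : Edge n
    closingJoin : Joins n k closing end start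
    distinct    : Unique verts
    long        : 3 ≤ length verts

cycleEdges : {n k : ℕ} .{{_ : NonZero n}} → Cycle n k → List (Edge n)
cycleEdges C = Cycle.closing C ∷ Cycle.pathEdges C

-- A signature: σ e ≡ true iff e is negative.
Signature : ℕ → Set
Signature n = Edge n → Bool

PositiveCycle : {n k : ℕ} .{{_ : NonZero n}} → Signature n → Cycle n k → Set
PositiveCycle σ C = foldr _xor_ false (map σ (cycleEdges C)) ≡ false

BalancedAfterDeleting : (n k : ℕ) .{{_ : NonZero n}} → Signature n → (Edge n → Bool) → Set
BalancedAfterDeleting n k σ δ =
  (C : Cycle n k) → All (λ e → δ e ≡ false) (cycleEdges C) → PositiveCycle σ C

card : (n : ℕ) → (Edge n → Bool) → ℕ
card n δ = sum (map (λ e → if δ e then 1 else 0) (allEdges n))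

FrustrationAtMost : (n k : ℕ) .{{_ : NonZero n}} → Signature n → ℕ → Set
FrustrationAtMost n k σ m = Σ (Edge n → Bool) λ δ → (card n δ ≤ m) × BalancedAfterDeleting n k σ δ

MaxFrustrationAtMost : (n k : ℕ) .{{_ : NonZero n}} → ℕ → Set
MaxFrustrationAtMost n k m = (σ : Signature n) → FrustrationAtMost n k σ m

module Submission where

-- For any switching s of the vertices, the edges that are negative in the
-- switched signature σˢ(xy) = s(x) ⊕ σ(xy) ⊕ s(y) form a deletion set leaving a
-- balanced graph (module Switching).  So it suffices to exhibit a switching
-- with at most ⌊n/2⌋ + 1 negative edges (module Construction).  The outer
-- vertices u_0,…,u_{n-1} form a cycle, and since k has an inverse a modulo n
-- the inner vertices form the cycle v_0, v_k, v_{2k}, … with v_i in position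
-- i·a mod n.  Switching each vertex by the sign of the path from the start of
-- its cycle leaves only the two closing edges negative.  Three free bits
-- remain: α flips u_{n-1}, β flips v_0 and c flips every inner vertex.  A
-- majority choice of c makes at most ⌊(n-2)/2⌋ of the spokes at 1,…,n-2
-- negative; then α (resp. β) makes the closing outer (resp. inner) edge and
-- the spoke at u_{n-1} (resp. v_0) cost at most one.

open import Defs
open import Data.Nat using (ℕ; zero; suc; _+_; _*_; _∸_; _≤_; _<_; NonZero; z≤n; s≤s; s≤s⁻¹; _≡ᵇ_; _≤?_)
open import Data.Nat.Properties
open import Data.Nat.DivMod
open import Data.Nat.GCD using (gcd; GCD; gcd-GCD; module Bézout)
open import Data.Nat.Solver using (module +-*-Solver)
open import Data.Nat.ListAction using (sum)
open import Algebra.Properties.CommutativeSemigroup +-commutativeSemigroup using (interchange)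
open import Data.Bool using (Bool; true; false; if_then_else_; _xor_; _∧_; not; T)
open import Data.Bool.Properties using (T-∧; xor-same; xor-assoc) renaming (_≟_ to _≟ᴮ_)
open import Data.Unit using (tt)
open import Data.Empty using (⊥-elim)
open import Data.Product using (Σ; _,_; proj₁; proj₂)
open import Data.Sum using (inj₁; inj₂)
open import Data.Fin as Fin using (Fin; toℕ; fromℕ<)
open import Data.Fin.Properties using (toℕ-fromℕ<; toℕ-injective; toℕ<n)
open import Data.List using (List; []; _∷_; map; foldr; tabulate; concatMap)
open import Data.List.Relation.Unary.All using (All; []; _∷_)
open import Function.Base using (_∘_)
open import Function.Bundles using (Equivalence)
open import Relation.Nullary using (yes; no)
open import Relation.Nullary.Decidable using (⌊_⌋; toWitness)
open import Relation.Binary.PropositionalEquality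

-- Boolean identities, decided by truth tables

BoolFun : ℕ → Set
BoolFun zero    = Bool
BoolFun (suc n) = Bool → BoolFun n

_≐_ : {n : ℕ} → BoolFun n → BoolFun n → Set
_≐_ {zero}  f g = f ≡ g
_≐_ {suc n} f g = ∀ x → f x ≐ g x

agreeEverywhere : (n : ℕ) → BoolFun n → BoolFun n → Bool
agreeEverywhere zero    f g = ⌊ f ≟ᴮ g ⌋
agreeEverywhere (suc n) f g =
  agreeEverywhere n (f true) (g true) ∧ agreeEverywhere n (f false) (g false)

-- a Boolean identity holds once it has been checked on every input; used with
-- the functions inferred from the goal, e.g.  byTruthTable 3 tt
byTruthTable : ∀ n {f g : BoolFun n} → T (agreeEverywhere n f g) → f ≐ g
byTruthTable zero    ok = toWitness ok
byTruthTable (suc n) ok with Equivalence.to T-∧ ok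
... | ok₁ , ok₀ = λ { true → byTruthTable n ok₁ ; false → byTruthTable n ok₀ }

-- Finite sums

bit : Bool → ℕ
bit b = if b then 1 else 0

sumTo : ℕ → (ℕ → ℕ) → ℕ
sumTo zero    f = 0
sumTo (suc n) f = f 0 + sumTo n (λ i → f (suc i))

sumTo-cong : ∀ n {f g : ℕ → ℕ} → (∀ i → i < n → f i ≡ g i) → sumTo n f ≡ sumTo n g
sumTo-cong zero    eq = refl
sumTo-cong (suc n) eq =
  cong₂ _+_ (eq 0 (s≤s z≤n)) (sumTo-cong n (λ i i<n → eq (suc i) (s≤s i<n)))

sumTo-mono : ∀ n {f g : ℕ → ℕ} → (∀ i → i < n → f i ≤ g i) → sumTo n f ≤ sumTo n g
sumTo-mono zero    le = z≤n
sumTo-mono (suc n) le =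
  +-mono-≤ (le 0 (s≤s z≤n)) (sumTo-mono n (λ i i<n → le (suc i) (s≤s i<n)))

sumTo-+ : ∀ n (f g : ℕ → ℕ) → sumTo n (λ i → f i + g i) ≡ sumTo n f + sumTo n g
sumTo-+ zero    f g = refl
sumTo-+ (suc n) f g =
  trans (cong (f 0 + g 0 +_) (sumTo-+ n (λ i → f (suc i)) (λ i → g (suc i))))
        (interchange (f 0) (g 0) _ _)

sumTo-zero : ∀ n → sumTo n (λ _ → 0) ≡ 0
sumTo-zero zero    = refl
sumTo-zero (suc n) = sumTo-zero n

sumTo-last : ∀ n h → sumTo (suc n) h ≡ sumTo n h + h n
sumTo-last zero    h = +-comm (h 0) 0
sumTo-last (suc n) h =
  trans (cong (h 0 +_) (sumTo-last n (λ i → h (suc i)))) (sym (+-assoc (h 0) _ _))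

sumTo-ends : ∀ m h → sumTo (suc (suc m)) h ≡ h 0 + (sumTo m (λ i → h (suc i)) + h (suc m))
sumTo-ends m h = cong (h 0 +_) (sumTo-last m (λ i → h (suc i)))

flipAt : ℕ → Bool → ℕ → Bool
flipAt p b i = if i ≡ᵇ p then b else false

flipAt-hit : ∀ p b → flipAt p b p ≡ b
flipAt-hit zero    b = refl
flipAt-hit (suc p) b = flipAt-hit p b

flipAt-miss : ∀ {p i} b → i ≢ p → flipAt p b i ≡ false
flipAt-miss {zero}  {zero}  b i≢p = ⊥-elim (i≢p refl)
flipAt-miss {zero}  {suc i} b i≢p = refl
flipAt-miss {suc p} {zero}  b i≢p = refl
flipAt-miss {suc p} {suc i} b i≢p = flipAt-miss {p} {i} b (i≢p ∘ cong suc)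

sumTo-flipAt : ∀ n p b → sumTo n (λ i → bit (flipAt p b i)) ≤ bit b
sumTo-flipAt zero    p       b = z≤n
sumTo-flipAt (suc n) zero    b = ≤-reflexive (trans (cong (bit b +_) (sumTo-zero n)) (+-identityʳ (bit b)))
sumTo-flipAt (suc n) (suc p) b = sumTo-flipAt n p b

sumTo-twoFlips : ∀ n p q b b′ (f : ℕ → ℕ) →
  (∀ i → i < n → f i ≤ bit (flipAt p b i) + bit (flipAt q b′ i)) → sumTo n f ≤ bit b + bit b′
sumTo-twoFlips n p q b b′ f le = begin
    sumTo n f
  ≤⟨ sumTo-mono n le ⟩
    sumTo n (λ i → bit (flipAt p b i) + bit (flipAt q b′ i))
  ≡⟨ sumTo-+ n _ _ ⟩
    sumTo n (λ i → bit (flipAt p b i)) + sumTo n (λ i → bit (flipAt q b′ i))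
  ≤⟨ +-mono-≤ (sumTo-flipAt n p b) (sumTo-flipAt n q b′) ⟩
    bit b + bit b′
  ∎
  where open ≤-Reasoning

sumTo-complement : ∀ n (g : ℕ → Bool) → sumTo n (λ i → bit (not (g i))) + sumTo n (λ i → bit (g i)) ≡ n
sumTo-complement zero    g = refl
sumTo-complement (suc n) g with g 0
... | false = cong suc (sumTo-complement n (λ i → g (suc i)))
... | true  = trans (+-suc (sumTo n (λ i → bit (not (g (suc i))))) _)
                    (cong suc (sumTo-complement n (λ i → g (suc i))))

-- m = (m mod 2) + 2⌊m/2⌋
m≤1+⌊m/2⌋+⌊m/2⌋ : ∀ m → m ≤ suc (m / 2 + m / 2)
m≤1+⌊m/2⌋+⌊m/2⌋ m = begin
    m
  ≡⟨ m≡m%n+[m/n]*n m 2 ⟩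
    m % 2 + (m / 2) * 2
  ≤⟨ +-monoˡ-≤ ((m / 2) * 2) (s≤s⁻¹ (m%n<n m 2)) ⟩
    1 + (m / 2) * 2
  ≡⟨ cong suc (trans (*-comm (m / 2) 2) (cong ((m / 2) +_) (+-identityʳ (m / 2)))) ⟩
    suc (m / 2 + m / 2)
  ∎
  where open ≤-Reasoning

majorityFlip : ∀ m (g : ℕ → Bool) → Σ Bool λ c → sumTo m (λ i → bit (c xor g i)) ≤ m / 2
majorityFlip m g with sumTo m (λ i → bit (g i)) ≤? m / 2
... | yes few  = false , few
... | no many = true , subst (_≤ m / 2) (sym complement) (m≤n+o⇒m∸n≤o m trues bound)
  where
  trues : ℕ
  trues = sumTo m (λ i → bit (g i))
  complement : sumTo m (λ i → bit (not (g i))) ≡ m ∸ trues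
  complement = trans (sym (m+n∸n≡m _ trues)) (cong (_∸ trues) (sumTo-complement m g))
  bound : m ≤ trues + m / 2
  bound = ≤-trans (m≤1+⌊m/2⌋+⌊m/2⌋ m) (+-monoˡ-≤ (m / 2) (≰⇒> many))

-- one free bit α can make a pair of cycle-closing edges (whose parity is ε) and
-- a further edge of sign x ⊕ α cost at most one negative edge in total
closingFlip : ∀ (ε x : Bool) → Σ Bool λ α → bit α + bit (ε xor α) + bit (x xor α) ≤ 1
closingFlip false false = false , z≤n
closingFlip false true  = false , s≤s z≤n
closingFlip true  false = false , s≤s z≤n
closingFlip true  true  = true  , s≤s z≤n

-- Switching

switchSign : (n k : ℕ) .{{_ : NonZero n}} → Signature n → (Vertex n → Bool) → Signature n
switchSign n k σ s e = σ e xor s (proj₁ (endpoints n k e)) xor s (proj₂ (endpoints n k e))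

module Switching (n k : ℕ) .{{_ : NonZero n}} (σ : Signature n) (s : Vertex n → Bool) where

  positive-after-switching : ∀ e x y → Joins n k e x y → switchSign n k σ s e ≡ false →
                             σ e ≡ s x xor s y
  positive-after-switching e x y (inj₁ eq) pos rewrite eq =
    trans (unswitch (σ e) (s x) (s y)) (cong (λ b → b xor s x xor s y) pos)
    where
    unswitch : ∀ a x y → a ≡ (a xor x xor y) xor x xor y
    unswitch = byTruthTable 3 tt
  positive-after-switching e x y (inj₂ eq) pos rewrite eq =
    trans (unswitch (σ e) (s x) (s y)) (cong (λ b → b xor s x xor s y) pos)
    where
    unswitch : ∀ a x y → a ≡ (a xor y xor x) xor x xor y
    unswitch = byTruthTable 3 tt

  -- along a walk avoiding edges negative after switching, the signs telescope
  walk-sign : ∀ {x z vs es} → Walk n k x z vs es → All (λ e → switchSign n k σ s e ≡ false) es →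
              foldr _xor_ false (map σ es) ≡ s x xor s z
  walk-sign {x} nil [] = sym (xor-same (s x))
  walk-sign {x} {z} (cons {y = y} e joins w) (pos ∷ poss) =
    trans (cong₂ _xor_ (positive-after-switching e _ _ joins pos) (walk-sign w poss))
          (telescope (s x) (s y) (s z))
    where
    telescope : ∀ x y z → (x xor y) xor (y xor z) ≡ x xor z
    telescope = byTruthTable 3 tt

  switching-balances : BalancedAfterDeleting n k σ (switchSign n k σ s)
  switching-balances C (pos ∷ poss) =
    trans (cong₂ _xor_ (positive-after-switching (Cycle.closing C) _ _ (Cycle.closingJoin C) pos)
                       (walk-sign (Cycle.walk C) poss))
          (closes (s (Cycle.start C)) (s (Cycle.end C)))
    where
    closes : ∀ x y → (y xor x) xor (x xor y) ≡ false
    closes = byTruthTable 2 tt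

-- Counting deleted edges index by index

deletedAt : {n : ℕ} → (Edge n → Bool) → Fin n → ℕ
deletedAt δ j = bit (δ (outer , j)) + (bit (δ (spoke , j)) + bit (δ (inner , j)))

edgesAt : {n : ℕ} → Fin n → List (Edge n)
edgesAt j = (outer , j) ∷ (spoke , j) ∷ (inner , j) ∷ []

sum-deletedAt : ∀ {n} (δ : Edge n → Bool) m (f : Fin m → Fin n) (h : ℕ → ℕ) →
  (∀ j → deletedAt δ (f j) ≡ h (toℕ j)) →
  sum (map (λ e → bit (δ e)) (concatMap edgesAt (tabulate f))) ≡ sumTo m h
sum-deletedAt δ zero    f h eq = refl
sum-deletedAt δ (suc m) f h eq = begin
    o + (s + (i + rest))
  ≡⟨ cong (o +_) (sym (+-assoc s i rest)) ⟩
    o + ((s + i) + rest)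
  ≡⟨ sym (+-assoc o (s + i) rest) ⟩
    deletedAt δ (f Fin.zero) + rest
  ≡⟨ cong₂ _+_ (eq Fin.zero) (sum-deletedAt δ m (λ j → f (Fin.suc j)) (λ i → h (suc i)) (λ j → eq (Fin.suc j))) ⟩
    h 0 + sumTo m (λ i → h (suc i))
  ∎
  where
  open ≡-Reasoning
  o s i rest : ℕ
  o = bit (δ (outer , f Fin.zero))
  s = bit (δ (spoke , f Fin.zero))
  i = bit (δ (inner , f Fin.zero))
  rest = sum (map (λ e → bit (δ e)) (concatMap edgesAt (tabulate (λ j → f (Fin.suc j)))))

-- Indices modulo n

idx : (n : ℕ) .{{_ : NonZero n}} → ℕ → Fin n
idx n i = fromℕ< (m%n<n i n)

module _ {n : ℕ} .{{_ : NonZero n}} where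

  toℕ-idx : ∀ {i} → i < n → toℕ (idx n i) ≡ i
  toℕ-idx {i} i<n = trans (toℕ-fromℕ< (m%n<n i n)) (m<n⇒m%n≡m i<n)

  idx-toℕ : (j : Fin n) → idx n (toℕ j) ≡ j
  idx-toℕ j = toℕ-injective (toℕ-idx (toℕ<n j))

  idx-cong : ∀ i j → i % n ≡ j % n → idx n i ≡ idx n j
  idx-cong i j eq =
    toℕ-injective (trans (toℕ-fromℕ< (m%n<n i n)) (trans eq (sym (toℕ-fromℕ< (m%n<n j n)))))

  toℕ-addMod : ∀ (j : Fin n) x → toℕ (addMod n j x) ≡ (toℕ j + x) % n
  toℕ-addMod j x = toℕ-fromℕ< (m%n<n (toℕ j + x) n)

  card-as-sum : (δ : Edge n → Bool) → card n δ ≡ sumTo n (λ i → deletedAt δ (idx n i))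
  card-as-sum δ = sum-deletedAt δ n (λ j → j) _ (λ j → cong (deletedAt δ) (sym (idx-toℕ j)))

module _ {d : ℕ} .{{_ : NonZero d}} where

  %-cong-+ : ∀ a a′ b b′ → a % d ≡ a′ % d → b % d ≡ b′ % d → (a + b) % d ≡ (a′ + b′) % d
  %-cong-+ a a′ b b′ p q =
    trans (%-distribˡ-+ a b d) (trans (cong₂ (λ x y → (x + y) % d) p q) (sym (%-distribˡ-+ a′ b′ d)))

  %-cong-* : ∀ a a′ b b′ → a % d ≡ a′ % d → b % d ≡ b′ % d → (a * b) % d ≡ (a′ * b′) % d
  %-cong-* a a′ b b′ p q =
    trans (%-distribˡ-* a b d) (trans (cong₂ (λ x y → (x * y) % d) p q) (sym (%-distribˡ-* a′ b′ d)))

-- for n ≥ 2, a number coprime to n is invertible modulo n: Bézout gives either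
-- 1 + x·n = y·k (take a = y) or 1 + y·k = x·n, i.e. y·k ≡ -1 (take a = (n-1)·y)
modInverse : ∀ m k → gcd (suc (suc m)) k ≡ 1 → Σ ℕ λ a → (a * k) % suc (suc m) ≡ 1
modInverse m k coprime with Bézout.identity (subst (GCD (suc (suc m)) k) coprime (gcd-GCD (suc (suc m)) k))
... | Bézout.-+ x y eq = y , trans (cong (_% suc (suc m)) (sym eq)) ([m+kn]%n≡m%n 1 x (suc (suc m)))
... | Bézout.+- x y eq = suc m * y , (begin
    (suc m * y * k) % N
  ≡⟨ sym ([m+kn]%n≡m%n (suc m * y * k) x N) ⟩
    (suc m * y * k + x * N) % N
  ≡⟨ cong (λ z → (suc m * y * k + z) % N) (sym eq) ⟩
    (suc m * y * k + (1 + y * k)) % N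
  ≡⟨ cong (_% N) (regroup m y k) ⟩
    (1 + y * k * N) % N
  ≡⟨ [m+kn]%n≡m%n 1 (y * k) N ⟩
    1
  ∎)
  where
  open ≡-Reasoning
  N : ℕ
  N = suc (suc m)
  regroup : ∀ m y k → suc m * y * k + (1 + y * k) ≡ 1 + y * k * suc (suc m)
  regroup = solve 3 (λ m y k → (con 1 :+ m) :* y :* k :+ (con 1 :+ y :* k) := con 1 :+ y :* k :* (con 2 :+ m)) refl
    where open +-*-Solver

-- A cheap switching of P_{n,k}, for n = m + 2 and a an inverse of k modulo n

module Construction (m k : ℕ) (σ : Signature (suc (suc m)))
                    (a : ℕ) (a-inverse : (a * k) % suc (suc m) ≡ 1) where

  N : ℕ
  N = suc (suc m)

  -- v_i is the (pos i)-th vertex of the inner cycle v_0, v_k, v_{2k}, …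
  pos : ℕ → ℕ
  pos i = (i * a) % N

  pos<N : ∀ i → pos i < N
  pos<N i = m%n<n (i * a) N

  pos-inverse : ∀ i → (pos i * k) % N ≡ i % N
  pos-inverse i = begin
      (pos i * k) % N    ≡⟨ %-cong-* (pos i) (i * a) k k (m%n%n≡m%n (i * a) N) refl ⟩
      (i * a * k) % N    ≡⟨ cong (_% N) (*-assoc i a k) ⟩
      (i * (a * k)) % N  ≡⟨ %-cong-* i i (a * k) 1 refl a-inverse ⟩
      (i * 1) % N        ≡⟨ cong (_% N) (*-identityʳ i) ⟩
      i % N              ∎
    where open ≡-Reasoning

  pos-step : ∀ i → suc (pos i) < N → pos ((i + k) % N) ≡ suc (pos i)
  pos-step i lt = begin
      (((i + k) % N) * a) % N  ≡⟨ %-cong-* ((i + k) % N) (i + k) a a (m%n%n≡m%n (i + k) N) refl ⟩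
      ((i + k) * a) % N        ≡⟨ cong (_% N) (*-distribʳ-+ a i k) ⟩
      (i * a + k * a) % N      ≡⟨ %-cong-+ (i * a) (pos i) (k * a) 1 (sym (m%n%n≡m%n (i * a) N))
                                            (trans (cong (_% N) (*-comm k a)) a-inverse) ⟩
      (pos i + 1) % N          ≡⟨ cong (_% N) (+-comm (pos i) 1) ⟩
      suc (pos i) % N          ≡⟨ m<n⇒m%n≡m lt ⟩
      suc (pos i)              ∎
    where open ≡-Reasoning

  -- the last vertex of the inner cycle is v_lastInner, and its inner edge returns to v_0
  lastInner : ℕ
  lastInner = (suc m * k) % N

  pos-last : ∀ i → pos i ≡ suc m → i % N ≡ lastInner
  pos-last i eq = trans (sym (pos-inverse i)) (cong (λ p → (p * k) % N) eq)

  wraps : ∀ i → pos i ≡ suc m → (i + k) % N ≡ 0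
  wraps i eq = begin
      (i + k) % N          ≡⟨ %-cong-+ i (suc m * k) k k (pos-last i eq) refl ⟩
      (suc m * k + k) % N  ≡⟨ cong (_% N) (trans (+-comm (suc m * k) k) (*-comm N k)) ⟩
      (k * N) % N          ≡⟨ m*n%n≡0 k N ⟩
      0                    ∎
    where open ≡-Reasoning

  notFirst : ∀ i {p} → pos i ≡ suc p → i ≢ 0
  notFirst i eq refl = 1+n≢0 (sym eq)

  outerSign spokeSign innerSign : ℕ → Bool
  outerSign i = σ (outer , idx N i)
  spokeSign i = σ (spoke , idx N i)
  innerSign i = σ (inner , idx N i)

  -- sign of the outer path u_0 u_1 … u_j
  outerPrefix : ℕ → Bool
  outerPrefix zero    = false
  outerPrefix (suc j) = outerPrefix j xor outerSign j

  -- sign of the inner path v_0 v_k … v_{jk}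
  innerPrefix : ℕ → Bool
  innerPrefix zero    = false
  innerPrefix (suc j) = innerPrefix j xor innerSign (j * k)

  uSwitch : Bool → ℕ → Bool
  uSwitch α j = outerPrefix j xor flipAt (suc m) α j

  vSwitch : Bool → Bool → ℕ → Bool
  vSwitch β c j = innerPrefix (pos j) xor c xor flipAt 0 β j

  switching : Bool → Bool → Bool → Vertex N → Bool
  switching α β c (false , j) = uSwitch α (toℕ j)
  switching α β c (true  , j) = vSwitch β c (toℕ j)

  -- switched sign of the spoke at i + 1 (for 0 ≤ i < m), apart from the bit c
  middleSpoke : ℕ → Bool
  middleSpoke i = spokeSign (suc i) xor outerPrefix (suc i) xor innerPrefix (pos (suc i))

  -- switched signs of the spokes at 0 and at n - 1, apart from the bits β and α
  firstSpoke lastSpoke : Bool → Bool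
  firstSpoke c = spokeSign 0 xor c
  lastSpoke  c = spokeSign (suc m) xor outerPrefix (suc m) xor innerPrefix (pos (suc m)) xor c

  module Costs (α β c : Bool) where

    negative : Signature N
    negative = switchSign N k σ (switching α β c)

    outerCost spokeCost innerCost : ℕ → ℕ
    outerCost i = bit (negative (outer , idx N i))
    spokeCost i = bit (negative (spoke , idx N i))
    innerCost i = bit (negative (inner , idx N i))

    outer-switched : ∀ {i} → i < N →
      negative (outer , idx N i) ≡ outerSign i xor uSwitch α i xor uSwitch α ((i + 1) % N)
    outer-switched {i} lt rewrite toℕ-addMod (idx N i) 1 | toℕ-idx lt = refl

    spoke-switched : ∀ {i} → i < N →
      negative (spoke , idx N i) ≡ spokeSign i xor uSwitch α i xor vSwitch β c i
    spoke-switched lt rewrite toℕ-idx lt = refl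

    inner-switched : ∀ {i} → i < N →
      negative (inner , idx N i) ≡ innerSign i xor vSwitch β c i xor vSwitch β c ((i + k) % N)
    inner-switched {i} lt rewrite toℕ-addMod (idx N i) k | toℕ-idx lt = refl

    outer-inside : ∀ {i} → i < suc m → outerCost i ≡ bit (flipAt m α i)
    outer-inside {i} i<1+m = begin
        outerCost i
      ≡⟨ cong bit (outer-switched (m≤n⇒m≤1+n i<1+m)) ⟩
        bit (outerSign i xor uSwitch α i xor uSwitch α ((i + 1) % N))
      ≡⟨ cong₂ (λ b j → bit (outerSign i xor (outerPrefix i xor b) xor uSwitch α j))
               (flipAt-miss α (<⇒≢ i<1+m)) next ⟩
        bit (outerSign i xor (outerPrefix i xor false)
                         xor ((outerPrefix i xor outerSign i) xor flipAt m α i))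
      ≡⟨ cong bit (cancel (outerSign i) (outerPrefix i) (flipAt m α i)) ⟩
        bit (flipAt m α i)
      ∎
      where
      open ≡-Reasoning
      next : (i + 1) % N ≡ suc i
      next = trans (cong (_% N) (+-comm i 1)) (m<n⇒m%n≡m (s≤s i<1+m))
      cancel : ∀ w p x → w xor (p xor false) xor ((p xor w) xor x) ≡ x
      cancel = byTruthTable 3 tt

    outer-closing : outerCost (suc m) ≡ bit (outerPrefix N xor α)
    outer-closing = begin
        outerCost (suc m)
      ≡⟨ cong bit (outer-switched ≤-refl) ⟩
        bit (outerSign (suc m) xor uSwitch α (suc m) xor uSwitch α ((suc m + 1) % N))
      ≡⟨ cong₂ (λ b j → bit (outerSign (suc m) xor (outerPrefix (suc m) xor b) xor uSwitch α j))
               (flipAt-hit (suc m) α) wrap ⟩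
        bit (outerSign (suc m) xor (outerPrefix (suc m) xor α) xor false)
      ≡⟨ cong bit (close (outerSign (suc m)) (outerPrefix (suc m)) α) ⟩
        bit (outerPrefix N xor α)
      ∎
      where
      open ≡-Reasoning
      wrap : (suc m + 1) % N ≡ 0
      wrap = trans (cong (_% N) (+-comm (suc m) 1)) (n%n≡0 N)
      close : ∀ w p x → w xor (p xor x) xor false ≡ (p xor w) xor x
      close = byTruthTable 3 tt

    outer-bound : ∀ i → i < N →
      outerCost i ≤ bit (flipAt m α i) + bit (flipAt (suc m) (outerPrefix N xor α) i)
    outer-bound i lt with m≤n⇒m<n∨m≡n (s≤s⁻¹ lt)
    ... | inj₁ i<1+m = ≤-trans (≤-reflexive (outer-inside i<1+m)) (m≤m+n _ _)
    ... | inj₂ refl  = ≤-reflexive (trans outer-closing (sym (cong₂ (λ x y → bit x + bit y)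
                         (flipAt-miss α (1+n≢n {m})) (flipAt-hit (suc m) (outerPrefix N xor α)))))

    inner-inside : ∀ {i} → i < N → pos i < suc m → innerCost i ≡ bit (flipAt 0 β i)
    inner-inside {i} lt pos<1+m = begin
        innerCost i
      ≡⟨ cong bit (inner-switched lt) ⟩
        bit (innerSign i xor vSwitch β c i xor vSwitch β c ((i + k) % N))
      ≡⟨ cong (λ x → bit (innerSign i xor vSwitch β c i xor x)) next ⟩
        bit (innerSign i xor (t xor c xor flipAt 0 β i) xor ((t xor innerSign i) xor c xor false))
      ≡⟨ cong bit (cancel (innerSign i) t c (flipAt 0 β i)) ⟩
        bit (flipAt 0 β i)
      ∎
      where
      open ≡-Reasoning
      t : Bool
      t = innerPrefix (pos i)
      step : pos ((i + k) % N) ≡ suc (pos i)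
      step = pos-step i (s≤s pos<1+m)
      sameEdge : innerSign (pos i * k) ≡ innerSign i
      sameEdge = cong (λ j → σ (inner , j)) (idx-cong (pos i * k) i (pos-inverse i))
      next : vSwitch β c ((i + k) % N) ≡ (t xor innerSign i) xor c xor false
      next = trans (cong₂ (λ p b → innerPrefix p xor c xor b) step (flipAt-miss β (notFirst ((i + k) % N) step)))
                   (cong (λ w → (t xor w) xor c xor false) sameEdge)
      cancel : ∀ w t c x → w xor (t xor c xor x) xor ((t xor w) xor c xor false) ≡ x
      cancel = byTruthTable 4 tt

    inner-closing : ∀ {i} → i < N → pos i ≡ suc m → innerCost i ≡ bit (innerPrefix N xor β)
    inner-closing {i} i<N pos≡1+m = begin
        innerCost i
      ≡⟨ cong bit (inner-switched i<N) ⟩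
        bit (innerSign i xor vSwitch β c i xor vSwitch β c ((i + k) % N))
      ≡⟨ cong₂ (λ b j → bit (innerSign i xor (innerPrefix (pos i) xor c xor b) xor vSwitch β c j))
               (flipAt-miss β (notFirst i pos≡1+m)) (wraps i pos≡1+m) ⟩
        bit (innerSign i xor (innerPrefix (pos i) xor c xor false) xor (c xor β))
      ≡⟨ cong₂ (λ w p → bit (w xor (innerPrefix p xor c xor false) xor (c xor β))) sameEdge pos≡1+m ⟩
        bit (innerSign (suc m * k) xor (innerPrefix (suc m) xor c xor false) xor (c xor β))
      ≡⟨ cong bit (close (innerSign (suc m * k)) (innerPrefix (suc m)) c β) ⟩
        bit (innerPrefix N xor β)
      ∎
      where
      open ≡-Reasoning
      sameEdge : innerSign i ≡ innerSign (suc m * k)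
      sameEdge = cong (λ j → σ (inner , j)) (idx-cong i (suc m * k) (pos-last i pos≡1+m))
      close : ∀ w t c x → w xor (t xor c xor false) xor (c xor x) ≡ (t xor w) xor x
      close = byTruthTable 4 tt

    inner-bound : ∀ i → i < N →
      innerCost i ≤ bit (flipAt 0 β i) + bit (flipAt lastInner (innerPrefix N xor β) i)
    inner-bound i lt with m≤n⇒m<n∨m≡n (s≤s⁻¹ (pos<N i))
    ... | inj₁ pos<1+m = ≤-trans (≤-reflexive (inner-inside lt pos<1+m)) (m≤m+n _ _)
    ... | inj₂ pos≡1+m = ≤-reflexive (trans (inner-closing lt pos≡1+m) (sym (cong₂ (λ x y → bit x + bit y)
                           (flipAt-miss β (notFirst i pos≡1+m)) isLast)))
      where
      isLast : flipAt lastInner (innerPrefix N xor β) i ≡ innerPrefix N xor β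
      isLast = trans (cong (flipAt lastInner (innerPrefix N xor β))
                           (trans (sym (m<n⇒m%n≡m lt)) (pos-last i pos≡1+m)))
                     (flipAt-hit lastInner (innerPrefix N xor β))

    spoke-first : spokeCost 0 ≡ bit (firstSpoke c xor β)
    spoke-first = cong bit (trans (spoke-switched (s≤s z≤n)) (sym (xor-assoc (spokeSign 0) c β)))

    spoke-last : spokeCost (suc m) ≡ bit (lastSpoke c xor α)
    spoke-last = begin
        spokeCost (suc m)
      ≡⟨ cong bit (spoke-switched ≤-refl) ⟩
        bit (w xor (p xor flipAt (suc m) α (suc m)) xor (t xor c xor false))
      ≡⟨ cong (λ b → bit (w xor (p xor b) xor (t xor c xor false))) (flipAt-hit (suc m) α) ⟩
        bit (w xor (p xor α) xor (t xor c xor false))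
      ≡⟨ cong bit (regroup w p t c α) ⟩
        bit (lastSpoke c xor α)
      ∎
      where
      open ≡-Reasoning
      w p t : Bool
      w = spokeSign (suc m)
      p = outerPrefix (suc m)
      t = innerPrefix (pos (suc m))
      regroup : ∀ w p t c x → w xor (p xor x) xor (t xor c xor false) ≡ (w xor p xor t xor c) xor x
      regroup = byTruthTable 5 tt

    spoke-middle : ∀ i → i < m → spokeCost (suc i) ≡ bit (c xor middleSpoke i)
    spoke-middle i i<m = begin
        spokeCost (suc i)
      ≡⟨ cong bit (spoke-switched (s≤s (s≤s (<⇒≤ i<m)))) ⟩
        bit (w xor (p xor flipAt m α i) xor (t xor c xor false))
      ≡⟨ cong (λ b → bit (w xor (p xor b) xor (t xor c xor false))) (flipAt-miss α (<⇒≢ i<m)) ⟩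
        bit (w xor (p xor false) xor (t xor c xor false))
      ≡⟨ cong bit (regroup w p t c) ⟩
        bit (c xor middleSpoke i)
      ∎
      where
      open ≡-Reasoning
      w p t : Bool
      w = spokeSign (suc i)
      p = outerPrefix (suc i)
      t = innerPrefix (pos (suc i))
      regroup : ∀ w p t c → w xor (p xor false) xor (t xor c xor false) ≡ c xor (w xor p xor t)
      regroup = byTruthTable 4 tt

    card-bound : card N negative ≤
        (bit α + bit (outerPrefix N xor α) + spokeCost (suc m))
      + (bit β + bit (innerPrefix N xor β) + spokeCost 0)
      + sumTo m (λ i → bit (c xor middleSpoke i))
    card-bound = begin
        card N negative
      ≡⟨ card-as-sum negative ⟩
        sumTo N (λ i → outerCost i + (spokeCost i + innerCost i))
      ≡⟨ trans (sumTo-+ N outerCost (λ i → spokeCost i + innerCost i))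
               (cong (sumTo N outerCost +_) (sumTo-+ N spokeCost innerCost)) ⟩
        sumTo N outerCost + (sumTo N spokeCost + sumTo N innerCost)
      ≤⟨ +-mono-≤ outer-total (+-mono-≤ (≤-reflexive spoke-total) inner-total) ⟩
        outerPart + ((spokeCost 0 + (middle + spokeCost (suc m))) + innerPart)
      ≡⟨ regroup outerPart (spokeCost 0) middle (spokeCost (suc m)) innerPart ⟩
        (outerPart + spokeCost (suc m)) + (innerPart + spokeCost 0) + middle
      ∎
      where
      open ≤-Reasoning
      outerPart innerPart middle : ℕ
      outerPart = bit α + bit (outerPrefix N xor α)
      innerPart = bit β + bit (innerPrefix N xor β)
      middle = sumTo m (λ i → bit (c xor middleSpoke i))
      outer-total : sumTo N outerCost ≤ outerPart
      outer-total = sumTo-twoFlips N m (suc m) α _ outerCost outer-bound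
      inner-total : sumTo N innerCost ≤ innerPart
      inner-total = sumTo-twoFlips N 0 lastInner β _ innerCost inner-bound
      spoke-total : sumTo N spokeCost ≡ spokeCost 0 + (middle + spokeCost (suc m))
      spoke-total = trans (sumTo-ends m spokeCost)
                          (cong (λ x → spokeCost 0 + (x + spokeCost (suc m))) (sumTo-cong m spoke-middle))
      regroup : ∀ o s₀ x s₁ i → o + ((s₀ + (x + s₁)) + i) ≡ (o + s₁) + (i + s₀) + x
      regroup = solve 5 (λ o s₀ x s₁ i → o :+ ((s₀ :+ (x :+ s₁)) :+ i) := (o :+ s₁) :+ (i :+ s₀) :+ x) refl
        where open +-*-Solver

  cheapSwitching : Σ (Vertex N → Bool) λ s → card N (switchSign N k σ s) ≤ N / 2 + 1
  cheapSwitching = switching α β c , (begin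
      card N (Costs.negative α β c)
    ≤⟨ Costs.card-bound α β c ⟩
        (bit α + bit (outerPrefix N xor α) + Costs.spokeCost α β c (suc m))
      + (bit β + bit (innerPrefix N xor β) + Costs.spokeCost α β c 0)
      + sumTo m (λ i → bit (c xor middleSpoke i))
    ≤⟨ +-mono-≤ (+-mono-≤ α-cheap β-cheap) (proj₂ (majorityFlip m middleSpoke)) ⟩
      1 + 1 + m / 2
    ≡⟨ trans (cong (_+ 1) (m/n≡1+[m∸n]/n {N} {2} (s≤s (s≤s z≤n)))) (+-comm (suc (m / 2)) 1) ⟨
      N / 2 + 1
    ∎)
    where
    open ≤-Reasoning
    c α β : Bool
    c = proj₁ (majorityFlip m middleSpoke)
    α = proj₁ (closingFlip (outerPrefix N) (lastSpoke c))
    β = proj₁ (closingFlip (innerPrefix N) (firstSpoke c))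
    α-cheap : bit α + bit (outerPrefix N xor α) + Costs.spokeCost α β c (suc m) ≤ 1
    α-cheap = subst (λ x → bit α + bit (outerPrefix N xor α) + x ≤ 1)
                    (sym (Costs.spoke-last α β c)) (proj₂ (closingFlip (outerPrefix N) (lastSpoke c)))
    β-cheap : bit β + bit (innerPrefix N xor β) + Costs.spokeCost α β c 0 ≤ 1
    β-cheap = subst (λ x → bit β + bit (innerPrefix N xor β) + x ≤ 1)
                    (sym (Costs.spoke-first α β c)) (proj₂ (closingFlip (innerPrefix N) (firstSpoke c)))

-- The theorem: only n ≥ 2 is needed (for n = 1 the hypotheses are contradictory),
-- and gcd(n,k) = 1 provides the inverse of k modulo n used by the construction

theorem3p3 : (n k : ℕ) .{{_ : NonZero n}} → 2 ≤ 2 * k → 2 * k < n → gcd n k ≡ 1 →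
    MaxFrustrationAtMost n k (n / 2 + 1)
theorem3p3 (suc zero)    k 2≤2k 2k<1 _ = ⊥-elim (<⇒≱ (≤-trans 2≤2k (s≤s⁻¹ 2k<1)) z≤n)
theorem3p3 (suc (suc m)) k _ _ coprime σ =
  switchSign (suc (suc m)) k σ s , fewNegative , Switching.switching-balances (suc (suc m)) k σ s
  where
  a : ℕ
  a = proj₁ (modInverse m k coprime)
  open Construction m k σ a (proj₂ (modInverse m k coprime)) using (N; cheapSwitching)
  s : Vertex N → Bool
  s = proj₁ cheapSwitching
  fewNegative : card N (switchSign N k σ s) ≤ N / 2 + 1
  fewNegative = proj₂ cheapSwitching
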